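{- For each of the pairs $(L,\ell)=(\mathbf{IL}^-(\mathbf{J2},\mathbf{J5}),\ \mathbf{il}^-(\mathbf{I4},\mathbf{J25}^u))$ and $(L,\ell)=(\mathbf{IL}^-(\mathbf{J2},\mathbf{J4}_+,\mathbf{J5}),\ \mathbf{il}^-(\mathbf{I2},\mathbf{J25}^u))$, and every $\mathcal{L}(\Box,\mathbf{I})$-formula $A$: if $L\vdash A$ then $\ell\vdash A$.
   Context: The language $\mathcal{L}(\Box,\rhd)$ consists of propositional variables, $\bot$, $\to$, unary $\Box$ and binary $\rhd$; other connectives as usual, $\Diamond A:\equiv\neg\Box\neg A$, $\mathbf{I}A:\equiv\top\rhd A$; $\mathcal{L}(\Box,\mathbf{I})$-formulas are those built from variables and $\bot$ by $\to$, $\Box$, $\mathbf{I}$. The logic $\mathbf{IL}^-$ has as axioms all tautologies, $\Box(A\to B)\to(\Box A\to\Box B)$, $\Box(\Box A\to A)\to\Box A$, $\mathbf{J3}$: $(A\rhd C)\land(B\rhd C)\to(A\lor B)\rhd C$, $\mathbf{J6}$: $\Box A\leftrightarrow(\neg A\rhd\bot)$; rules: Modus Ponens, Necessitation, from $A\to B$ infer $(C\rhd A)\to(C\rhd B)$, and from $A\to B$ infer $(B\rhd C)\to(A\rhd C)$. Schemata: $\mathbf{J2}$: $(A\rhd B)\land(B\rhd C)\to A\rhd C$; $\mathbf{J4}_+$: $\Box(A\to B)\to(C\rhd A\to C\rhd B)$; $\mathbf{J5}$: $\Diamond A\rhd A$. $L(\Sigma_1,\dots,\Sigma_k)$ is $L$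 with schemata $\Sigma_i$ added as axioms. The logic $\mathbf{il}^-$ has as axioms all tautologies of $\mathcal{L}(\Box,\mathbf{I})$, $\Box(A\to B)\to(\Box A\to\Box B)$, $\Box(\Box A\to A)\to\Box A$, $\Box\bot\leftrightarrow\mathbf{I}\bot$; rules Modus Ponens, Necessitation, and from $A\to B$ infer $\mathbf{I}A\to\mathbf{I}B$. Schemata: $\mathbf{I2}$: $\Box(A\to B)\to(\mathbf{I}A\to\mathbf{I}B)$; $\mathbf{I4}$: $\mathbf{I}A\land\Diamond\top\to\Diamond A$; $\mathbf{J25}^u$: $\Box(A\to\Diamond B)\to(\mathbf{I}A\to\mathbf{I}B)$. -}

module Defs where

open import Data.Nat using (ℕ)
open import Data.Bool using (Bool; true; false; not; _∨_)
open import Relation.Binary.PropositionalEquality using (_≡_)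
open import Data.Sum using (_⊎_)

infixr 5 _⇒_
infix 6 _▷_

data Fm : Set where
  var : ℕ → Fm
  ⊥'  : Fm
  _⇒_ : Fm → Fm → Fm
  □   : Fm → Fm
  _▷_ : Fm → Fm → Fm

¬' : Fm → Fm
¬' A = A ⇒ ⊥'

⊤' : Fm
⊤' = ⊥' ⇒ ⊥'

_∨'_ : Fm → Fm → Fm
A ∨' B = ¬' A ⇒ B

_∧'_ : Fm → Fm → Fm
A ∧' B = ¬' (A ⇒ ¬' B)

_⇔_ : Fm → Fm → Fm
A ⇔ B = (A ⇒ B) ∧' (B ⇒ A)

◇ : Fm → Fm
◇ A = ¬' (□ (¬' A))

eval : (Fm → Bool) → Fm → Bool
eval v (var p) = v (var p)
eval v ⊥' = false
eval v (A ⇒ B) = not (eval v A) ∨ eval v B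
eval v (□ A) = v (□ A)
eval v (A ▷ B) = v (A ▷ B)

Taut : Fm → Set
Taut A = (v : Fm → Bool) → eval v A ≡ true

data IL⁻ (Ax : Fm → Set) : Fm → Set where
  taut : ∀ {A} → Taut A → IL⁻ Ax A
  K    : ∀ A B → IL⁻ Ax (□ (A ⇒ B) ⇒ (□ A ⇒ □ B))
  Löb  : ∀ A → IL⁻ Ax (□ (□ A ⇒ A) ⇒ □ A)
  J3   : ∀ A B C → IL⁻ Ax (((A ▷ C) ∧' (B ▷ C)) ⇒ ((A ∨' B) ▷ C))
  J6   : ∀ A → IL⁻ Ax (□ A ⇔ (¬' A ▷ ⊥'))
  ax   : ∀ {A} → Ax A → IL⁻ Ax A
  mp   : ∀ {A B} → IL⁻ Ax (A ⇒ B) → IL⁻ Ax A → IL⁻ Ax B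
  nec  : ∀ {A} → IL⁻ Ax A → IL⁻ Ax (□ A)
  R1   : ∀ {A B} C → IL⁻ Ax (A ⇒ B) → IL⁻ Ax ((C ▷ A) ⇒ (C ▷ B))
  R2   : ∀ {A B} C → IL⁻ Ax (A ⇒ B) → IL⁻ Ax ((B ▷ C) ⇒ (A ▷ C))

data J2 : Fm → Set where
  j2 : ∀ A B C → J2 (((A ▷ B) ∧' (B ▷ C)) ⇒ (A ▷ C))

data J4₊ : Fm → Set where
  j4₊ : ∀ A B C → J4₊ (□ (A ⇒ B) ⇒ ((C ▷ A) ⇒ (C ▷ B)))

data J5 : Fm → Set where
  j5 : ∀ A → J5 (◇ A ▷ A)

data IFm : Set where
  var : ℕ → IFm
  ⊥'  : IFm
  _⇒_ : IFm → IFm → IFm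
  □   : IFm → IFm
  I   : IFm → IFm

¬ᵢ : IFm → IFm
¬ᵢ A = A ⇒ ⊥'

⊤ᵢ : IFm
⊤ᵢ = ⊥' ⇒ ⊥'

_∧ᵢ_ : IFm → IFm → IFm
A ∧ᵢ B = ¬ᵢ (A ⇒ ¬ᵢ B)

_⇔ᵢ_ : IFm → IFm → IFm
A ⇔ᵢ B = (A ⇒ B) ∧ᵢ (B ⇒ A)

◇ᵢ : IFm → IFm
◇ᵢ A = ¬ᵢ (□ (¬ᵢ A))

emb : IFm → Fm
emb (var p) = var p
emb ⊥' = ⊥'
emb (A ⇒ B) = emb A ⇒ emb B
emb (□ A) = □ (emb A)
emb (I A) = ⊤' ▷ emb A

evalᵢ : (IFm → Bool) → IFm → Bool
evalᵢ v (var p) = v (var p)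
evalᵢ v ⊥' = false
evalᵢ v (A ⇒ B) = not (evalᵢ v A) ∨ evalᵢ v B
evalᵢ v (□ A) = v (□ A)
evalᵢ v (I A) = v (I A)

Tautᵢ : IFm → Set
Tautᵢ A = (v : IFm → Bool) → evalᵢ v A ≡ true

data il⁻ (Ax : IFm → Set) : IFm → Set where
  taut : ∀ {A} → Tautᵢ A → il⁻ Ax A
  K    : ∀ A B → il⁻ Ax (□ (A ⇒ B) ⇒ (□ A ⇒ □ B))
  Löb  : ∀ A → il⁻ Ax (□ (□ A ⇒ A) ⇒ □ A)
  I⊥   : il⁻ Ax (□ ⊥' ⇔ᵢ I ⊥')
  ax   : ∀ {A} → Ax A → il⁻ Ax A
  mp   : ∀ {A B} → il⁻ Ax (A ⇒ B) → il⁻ Ax A → il⁻ Ax B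
  nec  : ∀ {A} → il⁻ Ax A → il⁻ Ax (□ A)
  RI   : ∀ {A B} → il⁻ Ax (A ⇒ B) → il⁻ Ax (I A ⇒ I B)

data I2 : IFm → Set where
  i2 : ∀ A B → I2 (□ (A ⇒ B) ⇒ (I A ⇒ I B))

data I4 : IFm → Set where
  i4 : ∀ A → I4 ((I A ∧ᵢ ◇ᵢ ⊤ᵢ) ⇒ ◇ᵢ A)

data J25u : IFm → Set where
  j25u : ∀ A B → J25u (□ (A ⇒ ◇ᵢ B) ⇒ (I A ⇒ I B))

_∪_ : ∀ {X : Set} → (X → Set) → (X → Set) → X → Set
(P ∪ Q) x = P x ⊎ Q x

-- Interpret A ▷ B in the language of I as  □ (A → ◇ B) ∨ I B.  Every axiom and
-- rule of IL⁻ becomes derivable in il⁻; J5 holds through the first disjunct, J2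
-- and J4₊ follow from J25u and I2 respectively.  On formulas ⊤ ▷ A coming from
-- I A the translation is equivalent to I A again: the extra disjunct □ ◇ A
-- gives □ (□ ⊥ → ⊥), hence □ ⊥ by Löb, hence I ⊥ and so I A.  Therefore every
-- IL-proof of emb A translates into an il-proof of A.
module Submission where

open import Defs
open import Data.Product using (_×_; _,_; proj₁; proj₂)
open import Data.Nat using (ℕ; zero; suc)
open import Data.Fin using (Fin; zero; suc)
open import Data.Vec using (Vec; []; _∷_; lookup; map)
open import Data.Vec.Properties using (lookup-map)
open import Data.Bool using (Bool; true; false; not; _∨_; _∧_; T)
open import Data.Bool.Properties using (T-∧; T-≡)
open import Data.Sum using (inj₁; inj₂)
open import Function using (flip)
open import Function.Bundles using (Equivalence)
open import Relation.Binary.PropositionalEquality using (_≡_; refl; sym; trans; cong₂)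

private
  variable
    n : ℕ

infixr 5 _⟶_

data Schema (n : ℕ) : Set where
  ‵_  : Fin n → Schema n
  ⊥ₛ  : Schema n
  _⟶_ : Schema n → Schema n → Schema n

⟦_⟧ : Schema n → Vec IFm n → IFm
⟦ ‵ i ⟧ σ = lookup σ i
⟦ ⊥ₛ ⟧ σ = ⊥'
⟦ φ ⟶ ψ ⟧ σ = ⟦ φ ⟧ σ ⇒ ⟦ ψ ⟧ σ

evalₛ : Vec Bool n → Schema n → Bool
evalₛ ρ (‵ i) = lookup ρ i
evalₛ ρ ⊥ₛ = false
evalₛ ρ (φ ⟶ ψ) = not (evalₛ ρ φ) ∨ evalₛ ρ ψ

allValuations : ∀ n → (Vec Bool n → Bool) → Bool
allValuations zero f = f []
allValuations (suc n) f = allValuations n (λ ρ → f (true ∷ ρ)) ∧ allValuations n (λ ρ → f (false ∷ ρ))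

allValuations-sound : ∀ n f → T (allValuations n f) → ∀ ρ → T (f ρ)
allValuations-sound zero f t [] = t
allValuations-sound (suc n) f t (true ∷ ρ) =
  allValuations-sound n _ (proj₁ (Equivalence.to T-∧ t)) ρ
allValuations-sound (suc n) f t (false ∷ ρ) =
  allValuations-sound n _ (proj₂ (Equivalence.to T-∧ t)) ρ

evalᵢ-⟦⟧ : ∀ v (φ : Schema n) σ → evalᵢ v (⟦ φ ⟧ σ) ≡ evalₛ (map (evalᵢ v) σ) φ
evalᵢ-⟦⟧ v (‵ i) σ = sym (lookup-map i (evalᵢ v) σ)
evalᵢ-⟦⟧ v ⊥ₛ σ = refl
evalᵢ-⟦⟧ v (φ ⟶ ψ) σ = cong₂ (λ x y → not x ∨ y) (evalᵢ-⟦⟧ v φ σ) (evalᵢ-⟦⟧ v ψ σ)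

Valid : Schema n → Set
Valid {n} φ = T (allValuations n (flip evalₛ φ))

-- The validity proof is an implicit argument of unit type, so Agda fills it
-- in by running the truth table.
tautology : ∀ {Ax} (φ : Schema n) σ → {Valid φ} → il⁻ Ax (⟦ φ ⟧ σ)
tautology {n} φ σ {valid} = taut λ v →
  trans (evalᵢ-⟦⟧ v φ σ) (Equivalence.to T-≡ (allValuations-sound n _ valid _))

¬ₛ_ : Schema n → Schema n
¬ₛ φ = φ ⟶ ⊥ₛ

_∧ₛ_ : Schema n → Schema n → Schema n
φ ∧ₛ ψ = ¬ₛ (φ ⟶ ¬ₛ ψ)

_∨ₛ_ : Schema n → Schema n → Schema n
φ ∨ₛ ψ = ¬ₛ φ ⟶ ψ

_⇔ₛ_ : Schema n → Schema n → Schema n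
φ ⇔ₛ ψ = (φ ⟶ ψ) ∧ₛ (ψ ⟶ φ)

infixl 6 _∧ₛ_ _∨ₛ_

p₀ : Schema (suc n)
p₀ = ‵ zero

p₁ : Schema (suc (suc n))
p₁ = ‵ suc zero

p₂ : Schema (suc (suc (suc n)))
p₂ = ‵ suc (suc zero)

p₃ : Schema (suc (suc (suc (suc n))))
p₃ = ‵ suc (suc (suc zero))

p₄ : Schema (suc (suc (suc (suc (suc n)))))
p₄ = ‵ suc (suc (suc (suc zero)))

_∨ᵢ_ : IFm → IFm → IFm
A ∨ᵢ B = ¬ᵢ A ⇒ B

infix 6 _▷ᵢ_

_▷ᵢ_ : IFm → IFm → IFm
C ▷ᵢ D = □ (C ⇒ ◇ᵢ D) ∨ᵢ I D

tr : Fm → IFm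
tr (var p) = var p
tr ⊥' = ⊥'
tr (A ⇒ B) = tr A ⇒ tr B
tr (□ A) = □ (tr A)
tr (A ▷ B) = tr A ▷ᵢ tr B

eval-tr : ∀ v A → eval (λ B → evalᵢ v (tr B)) A ≡ evalᵢ v (tr A)
eval-tr v (var p) = refl
eval-tr v ⊥' = refl
eval-tr v (A ⇒ B) = cong₂ (λ x y → not x ∨ y) (eval-tr v A) (eval-tr v B)
eval-tr v (□ A) = refl
eval-tr v (A ▷ B) = refl

tr-taut : ∀ {A} → Taut A → Tautᵢ (tr A)
tr-taut {A} t v = trans (sym (eval-tr v A)) (t _)

module _ {Ax : IFm → Set} where

  mp₂ : ∀ {A B C} → il⁻ Ax (A ⇒ B ⇒ C) → il⁻ Ax A → il⁻ Ax B → il⁻ Ax C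
  mp₂ t p q = mp (mp t p) q

  ⇒-trans : ∀ {A B C} → il⁻ Ax (A ⇒ B) → il⁻ Ax (B ⇒ C) → il⁻ Ax (A ⇒ C)
  ⇒-trans {A} {B} {C} = mp₂ (tautology ((p₀ ⟶ p₁) ⟶ (p₁ ⟶ p₂) ⟶ p₀ ⟶ p₂) (A ∷ B ∷ C ∷ []))

  □-mono : ∀ {A B} → il⁻ Ax (A ⇒ B) → il⁻ Ax (□ A ⇒ □ B)
  □-mono {A} {B} p = mp (K A B) (nec p)

  □-mono₂ : ∀ {A B C} → il⁻ Ax (A ⇒ B ⇒ C) → il⁻ Ax (□ A ⇒ □ B ⇒ □ C)
  □-mono₂ {A} {B} {C} p = ⇒-trans (□-mono p) (K B C)

  -- Löb applied to □ A ∧ A.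
  □⇒□□ : ∀ A → il⁻ Ax (□ A ⇒ □ (□ A))
  □⇒□□ A = ⇒-trans (□-mono A⇒□B⇒B) (⇒-trans (Löb B) (□-mono (tautology (p₀ ∧ₛ p₁ ⟶ p₀) (□ A ∷ A ∷ []))))
    where
    B : IFm
    B = □ A ∧ᵢ A
    A⇒□B⇒B : il⁻ Ax (A ⇒ □ B ⇒ B)
    A⇒□B⇒B = mp (tautology ((p₀ ⟶ p₁) ⟶ p₂ ⟶ p₀ ⟶ p₁ ∧ₛ p₂) (□ B ∷ □ A ∷ A ∷ []))
                (□-mono (tautology (p₀ ∧ₛ p₁ ⟶ p₁) (□ A ∷ A ∷ [])))

  ◇-mono□ : ∀ A B → il⁻ Ax (□ (A ⇒ B) ⇒ ◇ᵢ A ⇒ ◇ᵢ B)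
  ◇-mono□ A B =
    ⇒-trans (⇒-trans (□-mono (contrapose A B)) (K (¬ᵢ B) (¬ᵢ A))) (contrapose (□ (¬ᵢ B)) (□ (¬ᵢ A)))
    where
    contrapose : ∀ C D → il⁻ Ax ((C ⇒ D) ⇒ ¬ᵢ D ⇒ ¬ᵢ C)
    contrapose C D = tautology ((p₀ ⟶ p₁) ⟶ ¬ₛ p₁ ⟶ ¬ₛ p₀) (C ∷ D ∷ [])

  ◇-mono : ∀ {A B} → il⁻ Ax (A ⇒ B) → il⁻ Ax (◇ᵢ A ⇒ ◇ᵢ B)
  ◇-mono {A} {B} p = mp (◇-mono□ A B) (nec p)

  □◇-mono□ : ∀ A B → il⁻ Ax (□ (A ⇒ B) ⇒ □ (◇ᵢ A ⇒ ◇ᵢ B))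
  □◇-mono□ A B = ⇒-trans (□⇒□□ _) (□-mono (◇-mono□ A B))

  ◇◇⇒◇ : ∀ A → il⁻ Ax (◇ᵢ (◇ᵢ A) ⇒ ◇ᵢ A)
  ◇◇⇒◇ A = mp (tautology ((p₀ ⟶ p₁) ⟶ ¬ₛ p₁ ⟶ ¬ₛ p₀) (□ (¬ᵢ A) ∷ □ (¬ᵢ (◇ᵢ A)) ∷ []))
              (⇒-trans (□⇒□□ (¬ᵢ A)) (□-mono (tautology (p₀ ⟶ ¬ₛ ¬ₛ p₀) (□ (¬ᵢ A) ∷ []))))

  □◇-trans : ∀ A B C → il⁻ Ax (□ (A ⇒ ◇ᵢ B) ⇒ □ (B ⇒ ◇ᵢ C) ⇒ □ (A ⇒ ◇ᵢ C))
  □◇-trans A B C =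
    mp₂ (tautology ((p₀ ⟶ p₁ ⟶ p₂) ⟶ (p₃ ⟶ p₁) ⟶ p₀ ⟶ p₃ ⟶ p₂)
                   (□ (A ⇒ ◇ᵢ B) ∷ □ (◇ᵢ B ⇒ ◇ᵢ (◇ᵢ C)) ∷ □ (A ⇒ ◇ᵢ C) ∷ □ (B ⇒ ◇ᵢ C) ∷ []))
        (□-mono₂ (mp (tautology ((p₀ ⟶ p₁) ⟶ (p₂ ⟶ p₃) ⟶ (p₃ ⟶ p₀) ⟶ p₂ ⟶ p₁)
                                (◇ᵢ (◇ᵢ C) ∷ ◇ᵢ C ∷ A ∷ ◇ᵢ B ∷ []))
                     (◇◇⇒◇ C)))
        (□◇-mono□ B (◇ᵢ C))

  I⊥⇒□⊥ : il⁻ Ax (I ⊥' ⇒ □ ⊥')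
  I⊥⇒□⊥ = mp (tautology ((p₀ ⇔ₛ p₁) ⟶ p₁ ⟶ p₀) (□ ⊥' ∷ I ⊥' ∷ [])) I⊥

  □⊥⇒I⊥ : il⁻ Ax (□ ⊥' ⇒ I ⊥')
  □⊥⇒I⊥ = mp (tautology ((p₀ ⇔ₛ p₁) ⟶ p₀ ⟶ p₁) (□ ⊥' ∷ I ⊥' ∷ [])) I⊥

  □◇⇒I : ∀ A → il⁻ Ax (□ (⊤ᵢ ⇒ ◇ᵢ A) ⇒ I A)
  □◇⇒I A = ⇒-trans (⇒-trans (□-mono ⊤⇒◇A⇒¬□⊥) (Löb ⊥')) (⇒-trans □⊥⇒I⊥ (RI (tautology (⊥ₛ ⟶ p₀) (A ∷ []))))
    where
    ⊤⇒◇A⇒¬□⊥ : il⁻ Ax ((⊤ᵢ ⇒ ◇ᵢ A) ⇒ □ ⊥' ⇒ ⊥')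
    ⊤⇒◇A⇒¬□⊥ = mp (tautology ((p₀ ⟶ p₁) ⟶ ((⊥ₛ ⟶ ⊥ₛ) ⟶ ¬ₛ p₁) ⟶ p₀ ⟶ ⊥ₛ) (□ ⊥' ∷ □ (¬ᵢ A) ∷ []))
                   (□-mono (tautology (⊥ₛ ⟶ ¬ₛ p₀) (A ∷ [])))

  ▷ᵢ-R1 : ∀ {A B} C → il⁻ Ax (A ⇒ B) → il⁻ Ax (C ▷ᵢ A ⇒ C ▷ᵢ B)
  ▷ᵢ-R1 {A} {B} C p =
    mp₂ (tautology ((p₀ ⟶ p₁) ⟶ (p₂ ⟶ p₃) ⟶ p₀ ∨ₛ p₂ ⟶ p₁ ∨ₛ p₃)
                   (□ (C ⇒ ◇ᵢ A) ∷ □ (C ⇒ ◇ᵢ B) ∷ I A ∷ I B ∷ []))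
        (□-mono (mp (tautology ((p₀ ⟶ p₁) ⟶ (p₂ ⟶ p₀) ⟶ p₂ ⟶ p₁) (◇ᵢ A ∷ ◇ᵢ B ∷ C ∷ [])) (◇-mono p)))
        (RI p)

  ▷ᵢ-R2 : ∀ {A B} C → il⁻ Ax (A ⇒ B) → il⁻ Ax (B ▷ᵢ C ⇒ A ▷ᵢ C)
  ▷ᵢ-R2 {A} {B} C p =
    mp (tautology ((p₀ ⟶ p₁) ⟶ p₀ ∨ₛ p₂ ⟶ p₁ ∨ₛ p₂) (□ (B ⇒ ◇ᵢ C) ∷ □ (A ⇒ ◇ᵢ C) ∷ I C ∷ []))
       (□-mono (mp (tautology ((p₀ ⟶ p₁) ⟶ (p₁ ⟶ p₂) ⟶ p₀ ⟶ p₂) (A ∷ B ∷ ◇ᵢ C ∷ [])) p))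

  ▷ᵢ-J3 : ∀ A B C → il⁻ Ax ((A ▷ᵢ C) ∧ᵢ (B ▷ᵢ C) ⇒ (A ∨ᵢ B) ▷ᵢ C)
  ▷ᵢ-J3 A B C =
    mp (tautology ((p₀ ⟶ p₁ ⟶ p₂) ⟶ (p₀ ∨ₛ p₃) ∧ₛ (p₁ ∨ₛ p₃) ⟶ p₂ ∨ₛ p₃)
                  (□ (A ⇒ ◇ᵢ C) ∷ □ (B ⇒ ◇ᵢ C) ∷ □ ((A ∨ᵢ B) ⇒ ◇ᵢ C) ∷ I C ∷ []))
       (□-mono₂ (tautology ((p₀ ⟶ p₂) ⟶ (p₁ ⟶ p₂) ⟶ p₀ ∨ₛ p₁ ⟶ p₂) (A ∷ B ∷ ◇ᵢ C ∷ [])))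

  ▷ᵢ-J6 : ∀ A → il⁻ Ax (□ A ⇔ᵢ (¬ᵢ A ▷ᵢ ⊥'))
  ▷ᵢ-J6 A =
    mp₂ (mp (tautology ((p₀ ⟶ p₁) ⟶ (p₁ ⟶ p₀) ⟶ (p₂ ⟶ p₀) ⟶ p₀ ⇔ₛ (p₁ ∨ₛ p₂))
                       (□ A ∷ □ (¬ᵢ A ⇒ ◇ᵢ ⊥') ∷ I ⊥' ∷ []))
            (□-mono (tautology (p₀ ⟶ ¬ₛ p₀ ⟶ p₁) (A ∷ ◇ᵢ ⊥' ∷ []))))
        □[¬A⇒◇⊥]⇒□A
        (⇒-trans I⊥⇒□⊥ (□-mono (tautology (⊥ₛ ⟶ p₀) (A ∷ []))))
    where
    -- ◇ ⊥ is refuted inside □ because □ □ ⊤ holds.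
    □[¬A⇒◇⊥]⇒□A : il⁻ Ax (□ (¬ᵢ A ⇒ ◇ᵢ ⊥') ⇒ □ A)
    □[¬A⇒◇⊥]⇒□A =
      mp₂ (tautology ((p₀ ⟶ p₁ ⟶ p₂) ⟶ p₁ ⟶ p₀ ⟶ p₂) (□ (¬ᵢ A ⇒ ◇ᵢ ⊥') ∷ □ (□ ⊤ᵢ) ∷ □ A ∷ []))
          (□-mono₂ (tautology ((¬ₛ p₀ ⟶ ¬ₛ p₁) ⟶ p₁ ⟶ p₀) (A ∷ □ ⊤ᵢ ∷ [])))
          (nec (nec (tautology (⊥ₛ ⟶ ⊥ₛ) [])))

  ▷ᵢ-J5 : ∀ A → il⁻ Ax (◇ᵢ A ▷ᵢ A)
  ▷ᵢ-J5 A = mp (tautology (p₀ ⟶ p₀ ∨ₛ p₁) (□ (◇ᵢ A ⇒ ◇ᵢ A) ∷ I A ∷ []))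
               (nec (tautology (p₀ ⟶ p₀) (◇ᵢ A ∷ [])))

  ▷ᵢ-J2 : (∀ {A} → J25u A → il⁻ Ax A) → ∀ A B C → il⁻ Ax ((A ▷ᵢ B) ∧ᵢ (B ▷ᵢ C) ⇒ A ▷ᵢ C)
  ▷ᵢ-J2 j25u-derivable A B C =
    mp₂ (tautology ((p₀ ⟶ p₁ ⟶ p₂) ⟶ (p₁ ⟶ p₃ ⟶ p₄) ⟶ (p₀ ∨ₛ p₃) ∧ₛ (p₁ ∨ₛ p₄) ⟶ p₂ ∨ₛ p₄)
                   (□ (A ⇒ ◇ᵢ B) ∷ □ (B ⇒ ◇ᵢ C) ∷ □ (A ⇒ ◇ᵢ C) ∷ I B ∷ I C ∷ []))
        (□◇-trans A B C)
        (j25u-derivable (j25u B C))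

  ▷ᵢ-J4₊ : (∀ {A} → I2 A → il⁻ Ax A) → ∀ A B C → il⁻ Ax (□ (A ⇒ B) ⇒ C ▷ᵢ A ⇒ C ▷ᵢ B)
  ▷ᵢ-J4₊ i2-derivable A B C =
    mp₂ (tautology ((p₀ ⟶ p₁ ⟶ p₂) ⟶ (p₀ ⟶ p₃ ⟶ p₄) ⟶ p₀ ⟶ p₁ ∨ₛ p₃ ⟶ p₂ ∨ₛ p₄)
                   (□ (A ⇒ B) ∷ □ (C ⇒ ◇ᵢ A) ∷ □ (C ⇒ ◇ᵢ B) ∷ I A ∷ I B ∷ []))
        (⇒-trans (□◇-mono□ A B)
                 (□-mono₂ (tautology ((p₀ ⟶ p₁) ⟶ (p₂ ⟶ p₀) ⟶ p₂ ⟶ p₁) (◇ᵢ A ∷ ◇ᵢ B ∷ C ∷ []))))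
        (i2-derivable (i2 A B))

  tr-sound : ∀ {AxL} → (∀ {A} → AxL A → il⁻ Ax (tr A)) → ∀ {A} → IL⁻ AxL A → il⁻ Ax (tr A)
  tr-sound axioms (taut {A} t) = taut (tr-taut {A} t)
  tr-sound axioms (K A B) = K _ _
  tr-sound axioms (Löb A) = Löb _
  tr-sound axioms (J3 A B C) = ▷ᵢ-J3 _ _ _
  tr-sound axioms (J6 A) = ▷ᵢ-J6 _
  tr-sound axioms (ax a) = axioms a
  tr-sound axioms (mp p q) = mp (tr-sound axioms p) (tr-sound axioms q)
  tr-sound axioms (nec p) = nec (tr-sound axioms p)
  tr-sound axioms (R1 C p) = ▷ᵢ-R1 _ (tr-sound axioms p)
  tr-sound axioms (R2 C p) = ▷ᵢ-R2 _ (tr-sound axioms p)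

  tr-emb⇒ : ∀ A → il⁻ Ax (tr (emb A) ⇒ A)
  ⇒tr-emb : ∀ A → il⁻ Ax (A ⇒ tr (emb A))

  tr-emb⇒ (var x) = tautology (p₀ ⟶ p₀) (var x ∷ [])
  tr-emb⇒ ⊥' = tautology (⊥ₛ ⟶ ⊥ₛ) []
  tr-emb⇒ (A ⇒ B) =
    mp₂ (tautology ((p₀ ⟶ p₁) ⟶ (p₂ ⟶ p₃) ⟶ (p₁ ⟶ p₂) ⟶ p₀ ⟶ p₃) (A ∷ tr (emb A) ∷ tr (emb B) ∷ B ∷ []))
        (⇒tr-emb A) (tr-emb⇒ B)
  tr-emb⇒ (□ A) = □-mono (tr-emb⇒ A)
  tr-emb⇒ (I A) =
    mp₂ (tautology ((p₀ ⟶ p₂) ⟶ (p₁ ⟶ p₂) ⟶ p₀ ∨ₛ p₁ ⟶ p₂)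
                   (□ (⊤ᵢ ⇒ ◇ᵢ (tr (emb A))) ∷ I (tr (emb A)) ∷ I A ∷ []))
        (⇒-trans (□◇⇒I _) (RI (tr-emb⇒ A)))
        (RI (tr-emb⇒ A))

  ⇒tr-emb (var x) = tautology (p₀ ⟶ p₀) (var x ∷ [])
  ⇒tr-emb ⊥' = tautology (⊥ₛ ⟶ ⊥ₛ) []
  ⇒tr-emb (A ⇒ B) =
    mp₂ (tautology ((p₀ ⟶ p₁) ⟶ (p₂ ⟶ p₃) ⟶ (p₁ ⟶ p₂) ⟶ p₀ ⟶ p₃) (tr (emb A) ∷ A ∷ B ∷ tr (emb B) ∷ []))
        (tr-emb⇒ A) (⇒tr-emb B)
  ⇒tr-emb (□ A) = □-mono (⇒tr-emb A)
  ⇒tr-emb (I A) =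
    ⇒-trans (RI (⇒tr-emb A))
            (tautology (p₁ ⟶ p₀ ∨ₛ p₁) (□ (⊤ᵢ ⇒ ◇ᵢ (tr (emb A))) ∷ I (tr (emb A)) ∷ []))

  conservative : ∀ {AxL} → (∀ {A} → AxL A → il⁻ Ax (tr A)) → ∀ A → IL⁻ AxL (emb A) → il⁻ Ax A
  conservative axioms A d = mp (tr-emb⇒ A) (tr-sound axioms d)

tr-J2∪J5 : ∀ {A} → (J2 ∪ J5) A → il⁻ (I4 ∪ J25u) (tr A)
tr-J2∪J5 (inj₁ (j2 A B C)) = ▷ᵢ-J2 (λ a → ax (inj₂ a)) _ _ _
tr-J2∪J5 (inj₂ (j5 A)) = ▷ᵢ-J5 _

tr-J2∪J4₊∪J5 : ∀ {A} → (J2 ∪ (J4₊ ∪ J5)) A → il⁻ (I2 ∪ J25u) (tr A)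
tr-J2∪J4₊∪J5 (inj₁ (j2 A B C)) = ▷ᵢ-J2 (λ a → ax (inj₂ a)) _ _ _
tr-J2∪J4₊∪J5 (inj₂ (inj₁ (j4₊ A B C))) = ▷ᵢ-J4₊ (λ a → ax (inj₁ a)) _ _ _
tr-J2∪J4₊∪J5 (inj₂ (inj₂ (j5 A))) = ▷ᵢ-J5 _

theorem4p15 : ((A : IFm) → IL⁻ (J2 ∪ J5) (emb A) → il⁻ (I4 ∪ J25u) A)
            × ((A : IFm) → IL⁻ (J2 ∪ (J4₊ ∪ J5)) (emb A) → il⁻ (I2 ∪ J25u) A)
theorem4p15 = conservative tr-J2∪J5 , conservative tr-J2∪J4₊∪J5
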